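{- Let $G=(V,E)$ be a finite simple undirected graph and let $a,b\in V$ be twins, i.e. $\Gamma(a)=\Gamma(b)$. Then there exists a node ordering $\sigma'=x_1\cdots x_i\,a\,b\,x_{i+1}\cdots x_l$ of $G$, with $x_j\in V\setminus\{a,b\}$ (so $b$ is eliminated immediately after $a$), such that $\phi(G,\sigma')=\Phi(G)$.
   Context: $\Gamma(v)$ is the (open) neighborhood of $v$ in $G$. The deficiency of $v$ in $G$ is $D_G(v)=\{\{c,d\}: c,d\in\Gamma_G(v),\ c\neq d,\ \{c,d\}\notin E\}$. Eliminating $v$ from $G$ gives $G_v=(V\setminus\{v\},\,E(V\setminus\{v\})\cup D_G(v))$, where $E(U)$ denotes the edges with both endpoints in $U$. A node ordering of $G$ with $n=|V|$ is a bijection $\sigma:\{1,\dots,n\}\to V$, written $x_1x_2\cdots x_n$ with $\sigma(j)=x_j$; it defines $G^{(0)}=G$ and $G^{(i)}=(G^{(i-1)})_{\sigma(i)}$. Its fill-in is $\phi(G,\sigma)=\sum_{i=1}^n |D_{G^{(i-1)}}(\sigma(i))|$, and $\Phi(G)=\min_\sigma\phi(G,\sigma)$. -}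

module Defs where

open import Data.Nat using (ℕ; zero; suc; _+_; _<ᵇ_; _≤_)
open import Data.Bool using (Bool; true; false; _∧_; _∨_; not; if_then_else_)
open import Data.Fin using (Fin; zero; suc; toℕ; _≟_)
open import Data.List using (List; []; _∷_; map; allFin)
open import Data.Fin.Permutation using (Permutation′; _⟨$⟩ʳ_)
open import Relation.Nullary.Decidable using (⌊_⌋)
open import Relation.Binary.PropositionalEquality using (_≡_)

record Graph (n : ℕ) : Set where
  field
    adj     : Fin n → Fin n → Bool
    adj-sym : ∀ u v → adj u v ≡ adj v u
    adj-irr : ∀ v → adj v v ≡ false
open Graph public

Twins : ∀ {n} → Graph n → Fin n → Fin n → Set
Twins G a b = ∀ c → adj G a c ≡ adj G b c

count : ∀ {n} → (Fin n → Bool) → ℕ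
count {zero}  f = 0
count {suc n} f = (if f zero then 1 else 0) + count (λ i → f (suc i))

sumF : ∀ {n} → (Fin n → ℕ) → ℕ
sumF {zero}  f = 0
sumF {suc n} f = f zero + sumF (λ i → f (suc i))

-- State of the elimination game: the current graph is the one induced by
-- the edge relation `edge` on the set of still-present vertices `alive`.
record State (n : ℕ) : Set where
  constructor state
  field
    alive : Fin n → Bool
    edge  : Fin n → Fin n → Bool
open State public

inΓ : ∀ {n} → State n → Fin n → Fin n → Bool
inΓ s v c = alive s c ∧ edge s v c ∧ not ⌊ c ≟ v ⌋

deficiency : ∀ {n} → State n → Fin n → ℕ
deficiency s v =
  sumF (λ c → count (λ d →
    (toℕ c <ᵇ toℕ d) ∧ inΓ s v c ∧ inΓ s v d ∧ not (edge s c d)))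

eliminate : ∀ {n} → State n → Fin n → State n
eliminate s v = state
  (λ c → alive s c ∧ not ⌊ c ≟ v ⌋)
  (λ c d → edge s c d ∨ (inΓ s v c ∧ inΓ s v d ∧ not ⌊ c ≟ d ⌋))

fillList : ∀ {n} → State n → List (Fin n) → ℕ
fillList s []       = 0
fillList s (v ∷ vs) = deficiency s v + fillList (eliminate s v) vs

initial : ∀ {n} → Graph n → State n
initial G = state (λ _ → true) (adj G)

-- A node ordering is a bijection σ : {1..n} → V, here Fin n → Fin n;
-- x_j = σ(j).  φ(G,σ):
fillIn : ∀ {n} → Graph n → Permutation′ n → ℕ
fillIn G σ = fillList (initial G) (map (σ ⟨$⟩ʳ_) (allFin _))

IsMinimumFillIn : ∀ {n} → Graph n → Permutation′ n → Set
IsMinimumFillIn G σ = ∀ τ → fillIn G σ ≤ fillIn G τ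

module Submission where

-- After a is eliminated its twin b is simplicial: every other neighbour of b is a neighbour
-- of a, and those have just been made a clique.  A simplicial vertex costs no fill, and
-- eliminating it earlier never increases any later deficiency, because every later graph is
-- then an induced subgraph of the one it replaces.  So in an optimal ordering the later of
-- a, b can be moved right behind the earlier one.  If b comes first the two are then swapped,
-- which is free: twins have equal deficiency and either order leaves the same graph.

open import Defs
open import Data.Bool using (Bool; true; false; _∧_; _∨_; not; T)
import Data.Bool as Bool
open import Data.Bool.Properties using (∧-assoc; ∧-comm; not-¬; not-injective)
open import Data.Empty using (⊥-elim)
open import Data.Fin using (Fin; zero; suc; toℕ; _≟_; _<_; punchOut; cast)
import Data.Fin.Properties as Fin
open import Data.Fin.Permutation using (Permutation′; _⟨$⟩ʳ_; permutation)
import Data.Fin.Permutation as Perm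
open import Data.List using (List; []; _∷_; [_]; _++_; length; lookup; tabulate; map; allFin; filter; cartesianProductWith)
open import Data.List.Extrema.Nat using (argmin; argmin-all; f[argmin]≤f[xs])
open import Data.List.Membership.Propositional using (_∈_)
open import Data.List.Membership.Propositional.Properties
  using (∈-∃++; ∈-lookup; ∈-allFin; ∈-filter⁺; ∈-cartesianProductWith⁺)
open import Data.List.Properties using (length-++-sucʳ; map-tabulate; tabulate-cong; tabulate-lookup; length-tabulate)
open import Data.List.Relation.Unary.All using (All; []; _∷_)
import Data.List.Relation.Unary.All as All
open import Data.List.Relation.Unary.All.Properties using (all-filter)
import Data.List.Relation.Unary.Any as Any
open import Data.Nat using (ℕ; zero; suc; _+_; _≤_; _<ᵇ_; z≤n; s≤s)
import Data.Nat as ℕ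
open import Data.Nat.Properties
  using (≤-trans; ≤-reflexive; +-mono-≤; +-monoʳ-≤; m≤n+m; m≤n⇒m≤1+n; <ᵇ⇒<; n≮n; n<1+n; module ≤-Reasoning)
open import Data.Product using (Σ; ∃; ∃₂; _×_; _,_; proj₁; proj₂)
open import Data.Sum using (_⊎_; inj₁; inj₂)
open import Data.Unit using (⊤; tt)
open import Function using (_∘_; id)
open import Function.Bundles using (Injection)
open import Function.Definitions using (Injective)
open import Function.Properties.Inverse using (↔⇒↣)
open import Relation.Nullary using (Dec; yes; no; _×-dec_)
open import Relation.Nullary.Decidable using (⌊_⌋)
open import Relation.Binary.PropositionalEquality
  using (_≡_; _≢_; refl; sym; trans; cong; cong₂; subst; ≢-sym; module ≡-Reasoning)

SamePair : ∀ {A : Set} → A → A → A → A → Set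
SamePair a b y z = (y ≡ a × z ≡ b) ⊎ (y ≡ b × z ≡ a)

∧-true⁻ : ∀ {x y} → x ∧ y ≡ true → x ≡ true × y ≡ true
∧-true⁻ {true} y≡true = refl , y≡true

∧-true⁺ : ∀ {x y} → x ≡ true → y ≡ true → x ∧ y ≡ true
∧-true⁺ refl refl = refl

∨-true⁻ : ∀ {x y} → x ∨ y ≡ true → x ≡ true ⊎ y ≡ true
∨-true⁻ {true}  _      = inj₁ refl
∨-true⁻ {false} y≡true = inj₂ y≡true

∨-true⁺ˡ : ∀ {x y} → x ≡ true → x ∨ y ≡ true
∨-true⁺ˡ refl = refl

∨-true⁺ʳ : ∀ {x y} → y ≡ true → x ∨ y ≡ true
∨-true⁺ʳ {true}  _      = refl
∨-true⁺ʳ {false} y≡true = y≡true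

∨-absorbs-implied : ∀ {x y} → (y ≡ true → x ≡ true) → x ∨ y ≡ x
∨-absorbs-implied {true}          _   = refl
∨-absorbs-implied {false} {false} _   = refl
∨-absorbs-implied {false} {true}  y⇒x with () ← y⇒x refl

module _ {n : ℕ} where

  ≢⇒≠ᵇ : {c d : Fin n} → c ≢ d → not ⌊ c ≟ d ⌋ ≡ true
  ≢⇒≠ᵇ {c} {d} c≢d with c ≟ d
  ... | yes c≡d = ⊥-elim (c≢d c≡d)
  ... | no  _   = refl

  ≠ᵇ⇒≢ : {c d : Fin n} → not ⌊ c ≟ d ⌋ ≡ true → c ≢ d
  ≠ᵇ⇒≢ {c} {d} c≠d with c ≟ d
  ≠ᵇ⇒≢ () | yes _
  ... | no c≢d = c≢d

  ≠ᵇ-sym : (c d : Fin n) → not ⌊ c ≟ d ⌋ ≡ not ⌊ d ≟ c ⌋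
  ≠ᵇ-sym c d with c ≟ d | d ≟ c
  ... | yes _   | yes _   = refl
  ... | yes c≡d | no  d≢c = ⊥-elim (d≢c (sym c≡d))
  ... | no  c≢d | yes d≡c = ⊥-elim (c≢d (sym d≡c))
  ... | no  _   | no  _   = refl

  <ᵇ⇒≢ : {c d : Fin n} → (toℕ c <ᵇ toℕ d) ≡ true → c ≢ d
  <ᵇ⇒≢ {c} c<d refl = n≮n (toℕ c) (<ᵇ⇒< (toℕ c) (toℕ c) (subst T (sym c<d) _))

count-mono : ∀ {n} {f g : Fin n → Bool} → (∀ i → f i ≡ true → g i ≡ true) → count f ≤ count g
count-mono {zero}            _   = z≤n
count-mono {suc n} {f} {g} f⇒g with f zero in f₀ | g zero in g₀
... | true  | true  = s≤s (count-mono (f⇒g ∘ suc))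
... | true  | false with () ← trans (sym g₀) (f⇒g zero f₀)
... | false | true  = m≤n⇒m≤1+n (count-mono (f⇒g ∘ suc))
... | false | false = count-mono (f⇒g ∘ suc)

count≡0 : ∀ {n} {f : Fin n → Bool} → (∀ i → f i ≢ true) → count f ≡ 0
count≡0 {zero}      _     = refl
count≡0 {suc n} {f} never with f zero in f₀
... | true  = ⊥-elim (never zero f₀)
... | false = count≡0 (never ∘ suc)

sumF-mono : ∀ {n} {f g : Fin n → ℕ} → (∀ i → f i ≤ g i) → sumF f ≤ sumF g
sumF-mono {zero}  _   = z≤n
sumF-mono {suc n} f≤g = +-mono-≤ (f≤g zero) (sumF-mono (f≤g ∘ suc))

sumF≡0 : ∀ {n} {f : Fin n → ℕ} → (∀ i → f i ≡ 0) → sumF f ≡ 0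
sumF≡0 {zero}      _   = refl
sumF≡0 {suc n} {f} f≡0 rewrite f≡0 zero = sumF≡0 (f≡0 ∘ suc)

module _ {n : ℕ} where

  without : (Fin n → Bool) → Fin n → Fin n → Bool
  without α v c = α c ∧ not ⌊ c ≟ v ⌋

  -- without (alive s) v is alive (eliminate s v) definitionally, so Admissible (alive s) π says that
  -- π eliminates pairwise distinct vertices that are alive in s.
  Admissible : (Fin n → Bool) → List (Fin n) → Set
  Admissible α []      = ⊤
  Admissible α (v ∷ π) = α v ≡ true × Admissible (without α v) π

  admissible? : ∀ α π → Dec (Admissible α π)
  admissible? α []      = yes tt
  admissible? α (v ∷ π) = (α v Bool.≟ true) ×-dec admissible? (without α v) π

  admissible-mono : ∀ {α β} π → (∀ c → α c ≡ true → β c ≡ true) → Admissible α π → Admissible β π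
  admissible-mono []      _   _             = tt
  admissible-mono {α} {β} (v ∷ π) α⊆β (v-in , rest) =
    α⊆β v v-in , admissible-mono π without⊆ rest
    where
    without⊆ : ∀ c → without α v c ≡ true → without β v c ≡ true
    without⊆ c c-in = let c-in′ , c≠v = ∧-true⁻ c-in in ∧-true⁺ (α⊆β c c-in′) c≠v

  without-comm : ∀ α u v c → without (without α u) v c ≡ true → without (without α v) u c ≡ true
  without-comm α u v c c-in =
    let c-in′ , c≠v = ∧-true⁻ {without α u c} c-in
        c-in″ , c≠u = ∧-true⁻ {α c} c-in′
    in ∧-true⁺ (∧-true⁺ c-in″ c≠v) c≠u

  admissible-remove : ∀ {α} π₁ {z π₂} → Admissible α (π₁ ++ z ∷ π₂) →
    α z ≡ true × Admissible (without α z) (π₁ ++ π₂)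
  admissible-remove          []       adm           = adm
  admissible-remove {α} (v ∷ π₁) (v-in , rest) with admissible-remove π₁ rest
  ... | z-in , rest′ =
    let z-in′ , z≠v = ∧-true⁻ {α _} z-in
    in z-in′ , ∧-true⁺ v-in (≢⇒≠ᵇ (≢-sym (≠ᵇ⇒≢ z≠v))) ,
       admissible-mono (π₁ ++ _) (without-comm α v _) rest′

  admissible-pull : ∀ {α} y π₁ z π₂ → Admissible α (y ∷ π₁ ++ z ∷ π₂) →
    Admissible α (y ∷ z ∷ π₁ ++ π₂)
  admissible-pull y π₁ z π₂ (y-in , rest) = y-in , admissible-remove π₁ rest

  admissible-swap : ∀ {α} y z π → Admissible α (y ∷ z ∷ π) → Admissible α (z ∷ y ∷ π)
  admissible-swap {α} y z π (y-in , z-in , rest) =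
    let z-in′ , z≠y = ∧-true⁻ {α z} z-in
    in z-in′ , ∧-true⁺ y-in (≢⇒≠ᵇ (≢-sym (≠ᵇ⇒≢ z≠y))) , admissible-mono π (without-comm α y z) rest

  admissible-twins-first : ∀ π₁ π₂ {α} {a b y z : Fin n} → SamePair a b y z →
    Admissible α (y ∷ π₁ ++ z ∷ π₂) → Admissible α (a ∷ b ∷ π₁ ++ π₂)
  admissible-twins-first π₁ π₂ {a = a} {b} (inj₁ (refl , refl)) = admissible-pull a π₁ b π₂
  admissible-twins-first π₁ π₂ {a = a} {b} (inj₂ (refl , refl)) =
    admissible-swap b a _ ∘ admissible-pull b π₁ a π₂

  admissible-prefix : ∀ p {π π′} → (∀ α → Admissible α π → Admissible α π′) →
    ∀ {α} → Admissible α (p ++ π) → Admissible α (p ++ π′)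
  admissible-prefix []      π⇒π′ adm           = π⇒π′ _ adm
  admissible-prefix (v ∷ p) π⇒π′ (v-in , rest) = v-in , admissible-prefix p π⇒π′ rest

  admissible-lookup : ∀ {α} π → Admissible α π → ∀ i → α (lookup π i) ≡ true
  admissible-lookup (v ∷ π) (v-in , _) zero    = v-in
  admissible-lookup (v ∷ π) (_ , rest) (suc i) = proj₁ (∧-true⁻ (admissible-lookup π rest i))

  admissible-lookup-injective : ∀ {α} π → Admissible α π → Injective _≡_ _≡_ (lookup π)
  admissible-lookup-injective (v ∷ π) _          {zero}  {zero}  _      = refl
  admissible-lookup-injective (v ∷ π) (_ , rest) {zero}  {suc j} v≡πj  =
    ⊥-elim (≠ᵇ⇒≢ (proj₂ (∧-true⁻ (admissible-lookup π rest j))) (sym v≡πj))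
  admissible-lookup-injective (v ∷ π) (_ , rest) {suc i} {zero}  πi≡v  =
    ⊥-elim (≠ᵇ⇒≢ (proj₂ (∧-true⁻ (admissible-lookup π rest i))) πi≡v)
  admissible-lookup-injective (v ∷ π) (_ , rest) {suc i} {suc j} πi≡πj =
    cong suc (admissible-lookup-injective π rest πi≡πj)

  admissible-tabulate : ∀ {m} {f : Fin m → Fin n} α → Injective _≡_ _≡_ f → (∀ i → α (f i) ≡ true) →
    Admissible α (tabulate f)
  admissible-tabulate {zero}      _ _   _    = tt
  admissible-tabulate {suc m} {f} α inj f-in =
    f-in zero , admissible-tabulate (without α (f zero)) (Fin.suc-injective ∘ inj)
      (λ i → ∧-true⁺ (f-in (suc i)) (≢⇒≠ᵇ (λ fi≡f0 → Fin.0≢1+n (inj (sym fi≡f0)))))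

module _ {n : ℕ} where

  inΓ⁻ : ∀ (s : State n) v c → inΓ s v c ≡ true → alive s c ≡ true × edge s v c ≡ true × c ≢ v
  inΓ⁻ s v c c∈Γv =
    let c-alive , rest = ∧-true⁻ {alive s c} c∈Γv
        vc , c≠v       = ∧-true⁻ {edge s v c} rest
    in c-alive , vc , ≠ᵇ⇒≢ c≠v

  inΓ⁺ : ∀ (s : State n) v c → alive s c ≡ true → edge s v c ≡ true → c ≢ v → inΓ s v c ≡ true
  inΓ⁺ s v c c-alive vc c≢v = ∧-true⁺ c-alive (∧-true⁺ vc (≢⇒≠ᵇ c≢v))

  alive-eliminate⁻ : ∀ (s : State n) v c → alive (eliminate s v) c ≡ true → alive s c ≡ true × c ≢ v
  alive-eliminate⁻ s v c c-alive =
    let c-alive′ , c≠v = ∧-true⁻ {alive s c} c-alive in c-alive′ , ≠ᵇ⇒≢ c≠v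

  alive-eliminate⁺ : ∀ (s : State n) v c → alive s c ≡ true → c ≢ v → alive (eliminate s v) c ≡ true
  alive-eliminate⁺ s v c c-alive c≢v = ∧-true⁺ c-alive (≢⇒≠ᵇ c≢v)

  edge-eliminate⁻ : ∀ (s : State n) v c d → edge (eliminate s v) c d ≡ true →
    edge s c d ≡ true ⊎ (inΓ s v c ≡ true × inΓ s v d ≡ true)
  edge-eliminate⁻ s v c d cd with ∨-true⁻ {edge s c d} cd
  ... | inj₁ cd′  = inj₁ cd′
  ... | inj₂ fill = let vc , rest = ∧-true⁻ {inΓ s v c} fill in inj₂ (vc , proj₁ (∧-true⁻ {inΓ s v d} rest))

  edge-eliminate⁺ : ∀ (s : State n) v c d → edge s c d ≡ true → edge (eliminate s v) c d ≡ true
  edge-eliminate⁺ s v c d = ∨-true⁺ˡ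

  fill-edge : ∀ (s : State n) v c d → inΓ s v c ≡ true → inΓ s v d ≡ true → c ≢ d →
    edge (eliminate s v) c d ≡ true
  fill-edge s v c d vc vd c≢d = ∨-true⁺ʳ {edge s c d} (∧-true⁺ vc (∧-true⁺ vd (≢⇒≠ᵇ c≢d)))

  fillEdge : State n → Fin n → Fin n → Fin n → Bool
  fillEdge s v c d = (toℕ c <ᵇ toℕ d) ∧ inΓ s v c ∧ inΓ s v d ∧ not (edge s c d)

  fillEdge⁻ : ∀ (s : State n) v c d → fillEdge s v c d ≡ true →
    (toℕ c <ᵇ toℕ d) ≡ true × inΓ s v c ≡ true × inΓ s v d ≡ true × edge s c d ≡ false
  fillEdge⁻ s v c d fill =
    let c<d , rest  = ∧-true⁻ {toℕ c <ᵇ toℕ d} fill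
        vc  , rest′ = ∧-true⁻ {inΓ s v c} rest
        vd  , ¬cd   = ∧-true⁻ {inΓ s v d} rest′
    in c<d , vc , vd , not-injective {y = false} ¬cd

  fillEdge⁺ : ∀ (s : State n) v c d → (toℕ c <ᵇ toℕ d) ≡ true → inΓ s v c ≡ true → inΓ s v d ≡ true →
    edge s c d ≡ false → fillEdge s v c d ≡ true
  fillEdge⁺ s v c d c<d vc vd ¬cd = ∧-true⁺ c<d (∧-true⁺ vc (∧-true⁺ vd (cong not ¬cd)))

  deficiency-mono : ∀ (s : State n) v t w → (∀ c d → fillEdge s v c d ≡ true → fillEdge t w c d ≡ true) →
    deficiency s v ≤ deficiency t w
  deficiency-mono s v t w fill⇒fill = sumF-mono (λ c → count-mono (fill⇒fill c))

  deficiency≡0 : ∀ (s : State n) v → (∀ c d → fillEdge s v c d ≢ true) → deficiency s v ≡ 0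
  deficiency≡0 s v no-fill = sumF≡0 (λ c → count≡0 (no-fill c))

  SymmetricEdges : State n → Set
  SymmetricEdges s = ∀ c d → edge s c d ≡ edge s d c

  -- The edge {a, b} itself is excluded: eliminating a common neighbour creates it as fill.
  TwinsIn : State n → Fin n → Fin n → Set
  TwinsIn s a b = ∀ c → c ≢ a → c ≢ b → edge s a c ≡ edge s b c

  Simplicial : State n → Fin n → Set
  Simplicial s x = ∀ c d → inΓ s x c ≡ true → inΓ s x d ≡ true → c ≢ d → edge s c d ≡ true

  record IsInducedSubgraph (s′ s : State n) : Set where
    field
      alive⊆ : ∀ c → alive s′ c ≡ true → alive s c ≡ true
      edge≡  : ∀ c d → alive s′ c ≡ true → alive s′ d ≡ true → edge s′ c d ≡ edge s c d
  open IsInducedSubgraph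

  eliminate-symmetric : ∀ {s : State n} v → SymmetricEdges s → SymmetricEdges (eliminate s v)
  eliminate-symmetric {s} v symm c d = cong₂ _∨_ (symm c d) (begin
    inΓ s v c ∧ inΓ s v d ∧ not ⌊ c ≟ d ⌋   ≡⟨ cong (λ x → inΓ s v c ∧ inΓ s v d ∧ x) (≠ᵇ-sym c d) ⟩
    inΓ s v c ∧ inΓ s v d ∧ not ⌊ d ≟ c ⌋   ≡⟨ ∧-assoc (inΓ s v c) (inΓ s v d) _ ⟨
    (inΓ s v c ∧ inΓ s v d) ∧ not ⌊ d ≟ c ⌋ ≡⟨ cong (_∧ not ⌊ d ≟ c ⌋) (∧-comm (inΓ s v c) (inΓ s v d)) ⟩
    (inΓ s v d ∧ inΓ s v c) ∧ not ⌊ d ≟ c ⌋ ≡⟨ ∧-assoc (inΓ s v d) (inΓ s v c) _ ⟩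
    inΓ s v d ∧ inΓ s v c ∧ not ⌊ d ≟ c ⌋   ∎)
    where open ≡-Reasoning

  twins-sym : ∀ {s : State n} {a b} → TwinsIn s a b → TwinsIn s b a
  twins-sym twins c c≢b c≢a = sym (twins c c≢a c≢b)

  inΓ-twins : ∀ {s : State n} {a b} → TwinsIn s a b → ∀ c → c ≢ a → c ≢ b → inΓ s a c ≡ inΓ s b c
  inΓ-twins {s} twins c c≢a c≢b =
    cong₂ (λ e x → alive s c ∧ e ∧ x) (twins c c≢a c≢b) (trans (≢⇒≠ᵇ c≢a) (sym (≢⇒≠ᵇ c≢b)))

  twins-inΓ : ∀ {s : State n} {a b} v → SymmetricEdges s → TwinsIn s a b →
    alive s a ≡ true → alive s b ≡ true → v ≢ a → v ≢ b → inΓ s v a ≡ inΓ s v b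
  twins-inΓ {s} {a} {b} v symm twins a-alive b-alive v≢a v≢b =
    cong₂ _∧_ (trans a-alive (sym b-alive))
      (cong₂ _∧_ (trans (symm v a) (trans (twins v v≢a v≢b) (symm b v)))
                 (trans (≢⇒≠ᵇ (≢-sym v≢a)) (sym (≢⇒≠ᵇ (≢-sym v≢b)))))

  eliminate-twins : ∀ {s : State n} {a b} v → SymmetricEdges s → TwinsIn s a b →
    alive s a ≡ true → alive s b ≡ true → v ≢ a → v ≢ b → TwinsIn (eliminate s v) a b
  eliminate-twins {s} v symm twins a-alive b-alive v≢a v≢b c c≢a c≢b =
    cong₂ _∨_ (twins c c≢a c≢b)
      (cong₂ _∧_ (twins-inΓ v symm twins a-alive b-alive v≢a v≢b)
                 (cong (inΓ s v c ∧_) (trans (≢⇒≠ᵇ (≢-sym c≢a)) (sym (≢⇒≠ᵇ (≢-sym c≢b))))))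

  twin-simplicial : ∀ {s : State n} {a b} → TwinsIn s a b → Simplicial (eliminate s a) b
  twin-simplicial {s} {a} {b} twins c d bc bd c≢d =
    fill-edge s a c d (a-neighbour c bc) (a-neighbour d bd) c≢d
    where
    a-neighbour : ∀ c → inΓ (eliminate s a) b c ≡ true → inΓ s a c ≡ true
    a-neighbour c bc with inΓ⁻ (eliminate s a) b c bc
    ... | c-alive , b~c , c≢b with alive-eliminate⁻ s a c c-alive | edge-eliminate⁻ s a b c b~c
    ...   | c-alive′ , c≢a | inj₁ bc′      = inΓ⁺ s a c c-alive′ (trans (twins c c≢a c≢b) bc′) c≢a
    ...   | _              | inj₂ (_ , ac) = ac

  eliminate-simplicial : ∀ {s : State n} {x} v → SymmetricEdges s → Simplicial s x →
    alive s v ≡ true → v ≢ x → Simplicial (eliminate s v) x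
  eliminate-simplicial {s} {x} v symm simplicial v-alive v≢x c d xc xd c≢d =
    cases (neighbour c xc) (neighbour d xd)
    where
    neighbour : ∀ c → inΓ (eliminate s v) x c ≡ true → inΓ s x c ≡ true ⊎ inΓ s v x ≡ true
    neighbour c xc with inΓ⁻ (eliminate s v) x c xc
    ... | c-alive , x~c , c≢x with edge-eliminate⁻ s v x c x~c
    ...   | inj₁ xc′      = inj₁ (inΓ⁺ s x c (proj₁ (alive-eliminate⁻ s v c c-alive)) xc′ c≢x)
    ...   | inj₂ (vx , _) = inj₂ vx
    -- If x is a neighbour of v, the clique Γ(x) ∋ v forces every neighbour of x into Γ(v).
    via : inΓ s v x ≡ true → ∀ c → inΓ (eliminate s v) x c ≡ true → inΓ s v c ≡ true
    via vx c xc with inΓ⁻ (eliminate s v) x c xc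
    ... | c-alive , x~c , c≢x with alive-eliminate⁻ s v c c-alive | edge-eliminate⁻ s v x c x~c
    ...   | _              | inj₂ (_ , vc) = vc
    ...   | c-alive′ , c≢v | inj₁ xc′      =
      inΓ⁺ s v c c-alive′ (simplicial v c x~v x~c′ (≢-sym c≢v)) c≢v
      where
      x~v = inΓ⁺ s x v v-alive (trans (symm x v) (proj₁ (proj₂ (inΓ⁻ s v x vx)))) v≢x
      x~c′ = inΓ⁺ s x c c-alive′ xc′ c≢x
    cases : inΓ s x c ≡ true ⊎ inΓ s v x ≡ true → inΓ s x d ≡ true ⊎ inΓ s v x ≡ true →
      edge (eliminate s v) c d ≡ true
    cases (inj₁ xc′) (inj₁ xd′) = edge-eliminate⁺ s v c d (simplicial c d xc′ xd′ c≢d)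
    cases (inj₂ vx)  _          = fill-edge s v c d (via vx c xc) (via vx d xd) c≢d
    cases (inj₁ _)   (inj₂ vx)  = fill-edge s v c d (via vx c xc) (via vx d xd) c≢d

  simplicial-deficiency : ∀ {s : State n} {x} → Simplicial s x → deficiency s x ≡ 0
  simplicial-deficiency {s} {x} simplicial = deficiency≡0 s x no-fill
    where
    no-fill : ∀ c d → fillEdge s x c d ≢ true
    no-fill c d fill with fillEdge⁻ s x c d fill
    ... | c<d , xc , xd , ¬cd = not-¬ (simplicial c d xc xd (<ᵇ⇒≢ c<d)) ¬cd

  eliminate-simplicial-induced : ∀ {s : State n} {x} → Simplicial s x → IsInducedSubgraph (eliminate s x) s
  eliminate-simplicial-induced {s} {x} simplicial = record
    { alive⊆ = λ c → proj₁ ∘ alive-eliminate⁻ s x c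
    ; edge≡  = λ c d _ _ → ∨-absorbs-implied (fill⇒edge c d)
    }
    where
    fill⇒edge : ∀ c d → inΓ s x c ∧ inΓ s x d ∧ not ⌊ c ≟ d ⌋ ≡ true → edge s c d ≡ true
    fill⇒edge c d fill =
      let xc , rest = ∧-true⁻ {inΓ s x c} fill
          xd , c≠d  = ∧-true⁻ {inΓ s x d} rest
      in simplicial c d xc xd (≠ᵇ⇒≢ c≠d)

  induced-inΓ : ∀ {s′ s : State n} {v} → IsInducedSubgraph s′ s → alive s′ v ≡ true →
    ∀ c → alive s′ c ≡ true → inΓ s′ v c ≡ inΓ s v c
  induced-inΓ {s′} {s} {v} induced v-alive c c-alive =
    cong₂ (λ l e → l ∧ e ∧ not ⌊ c ≟ v ⌋) (trans c-alive (sym (alive⊆ induced c c-alive)))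
      (edge≡ induced v c v-alive c-alive)

  eliminate-induced : ∀ {s′ s : State n} {v} → IsInducedSubgraph s′ s → alive s′ v ≡ true →
    IsInducedSubgraph (eliminate s′ v) (eliminate s v)
  eliminate-induced {s′} {s} {v} induced v-alive = record
    { alive⊆ = λ c c-alive → let c-alive′ , c≢v = alive-eliminate⁻ s′ v c c-alive
                              in alive-eliminate⁺ s v c (alive⊆ induced c c-alive′) c≢v
    ; edge≡  = λ c d c-alive d-alive →
        let c-alive′ = proj₁ (alive-eliminate⁻ s′ v c c-alive)
            d-alive′ = proj₁ (alive-eliminate⁻ s′ v d d-alive)
        in cong₂ _∨_ (edge≡ induced c d c-alive′ d-alive′)
             (cong₂ (λ vc vd → vc ∧ vd ∧ not ⌊ c ≟ d ⌋)
               (induced-inΓ induced v-alive c c-alive′) (induced-inΓ induced v-alive d d-alive′))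
    }

  deficiency-induced : ∀ {s′ s : State n} {v} → IsInducedSubgraph s′ s → alive s′ v ≡ true →
    deficiency s′ v ≤ deficiency s v
  deficiency-induced {s′} {s} {v} induced v-alive = deficiency-mono s′ v s v fill⇒fill
    where
    inΓ⇒inΓ : ∀ c → inΓ s′ v c ≡ true → inΓ s v c ≡ true
    inΓ⇒inΓ c vc = trans (sym (induced-inΓ induced v-alive c (proj₁ (inΓ⁻ s′ v c vc)))) vc
    fill⇒fill : ∀ c d → fillEdge s′ v c d ≡ true → fillEdge s v c d ≡ true
    fill⇒fill c d fill with fillEdge⁻ s′ v c d fill
    ... | c<d , vc , vd , ¬cd = fillEdge⁺ s v c d c<d (inΓ⇒inΓ c vc) (inΓ⇒inΓ d vd)
      (trans (sym (edge≡ induced c d (proj₁ (inΓ⁻ s′ v c vc)) (proj₁ (inΓ⁻ s′ v d vd)))) ¬cd)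

  induced-via : ∀ {s′ t s : State n} → IsInducedSubgraph s′ s → IsInducedSubgraph t s →
    (∀ c → alive s′ c ≡ true → alive t c ≡ true) → IsInducedSubgraph s′ t
  induced-via s′⊑s t⊑s alive⊆t = record
    { alive⊆ = alive⊆t
    ; edge≡  = λ c d c-alive d-alive →
        trans (edge≡ s′⊑s c d c-alive d-alive) (sym (edge≡ t⊑s c d (alive⊆t c c-alive) (alive⊆t d d-alive)))
    }

  fillList-induced : ∀ π {s′ s : State n} → IsInducedSubgraph s′ s → Admissible (alive s′) π →
    fillList s′ π ≤ fillList s π
  fillList-induced []      _       _                = z≤n
  fillList-induced (v ∷ π) induced (v-alive , rest) =
    +-mono-≤ (deficiency-induced induced v-alive) (fillList-induced π (eliminate-induced induced v-alive) rest)

  fillList-postpone-simplicial : ∀ π₁ π₂ {s′ s : State n} {x} → IsInducedSubgraph s′ s →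
    (∀ c → alive s′ c ≡ true → c ≢ x) → SymmetricEdges s → Simplicial s x →
    Admissible (alive s′) (π₁ ++ π₂) → fillList s′ (π₁ ++ π₂) ≤ fillList s (π₁ ++ x ∷ π₂)
  fillList-postpone-simplicial [] π₂ {s′} {s} {x} induced x-dead _ simplicial adm =
    ≤-trans (fillList-induced π₂ (induced-via induced (eliminate-simplicial-induced simplicial) s′⊆s-x) adm)
            (m≤n+m _ _)
    where
    s′⊆s-x : ∀ c → alive s′ c ≡ true → alive (eliminate s x) c ≡ true
    s′⊆s-x c c-alive = alive-eliminate⁺ s x c (alive⊆ induced c c-alive) (x-dead c c-alive)
  fillList-postpone-simplicial (v ∷ π₁) π₂ {s′} {s} {x} induced x-dead symm simplicial (v-alive , adm) =
    +-mono-≤ (deficiency-induced induced v-alive)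
      (fillList-postpone-simplicial π₁ π₂ {eliminate s′ v} {eliminate s v} {x}
        (eliminate-induced induced v-alive)
        (λ c → x-dead c ∘ proj₁ ∘ alive-eliminate⁻ s′ v c)
        (eliminate-symmetric {s} v symm)
        (eliminate-simplicial {s} {x} v symm simplicial (alive⊆ induced v v-alive) (x-dead v v-alive))
        adm)

  fillList-simplicial-first : ∀ π₁ π₂ {s : State n} {x} → SymmetricEdges s → Simplicial s x →
    Admissible (alive s) (π₁ ++ x ∷ π₂) → fillList s (x ∷ π₁ ++ π₂) ≤ fillList s (π₁ ++ x ∷ π₂)
  fillList-simplicial-first π₁ π₂ {s} {x} symm simplicial adm = begin
    deficiency s x + later    ≡⟨ cong (_+ later) no-fill ⟩
    later                     ≤⟨ postponed ⟩
    fillList s (π₁ ++ x ∷ π₂) ∎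
    where
    open ≤-Reasoning
    later = fillList (eliminate s x) (π₁ ++ π₂)
    no-fill = simplicial-deficiency {s} {x} simplicial
    postponed = fillList-postpone-simplicial π₁ π₂ (eliminate-simplicial-induced simplicial)
      (λ c → proj₂ ∘ alive-eliminate⁻ s x c) symm simplicial (proj₂ (admissible-remove π₁ adm))

  deficiency-twin-≤ : ∀ {s : State n} {a b} → SymmetricEdges s → TwinsIn s a b → deficiency s a ≤ deficiency s b
  deficiency-twin-≤ {s} {a} {b} symm twins = deficiency-mono s a s b fill⇒fill
    where
    -- A fill pair of a cannot contain b: its other member would be a common neighbour of a and b.
    b-neighbour : ∀ c d → inΓ s a c ≡ true → inΓ s a d ≡ true → c ≢ d → edge s c d ≡ false →
      inΓ s b c ≡ true
    b-neighbour c d ac ad c≢d ¬cd with b ≟ c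
    ... | yes refl =
      let _ , ad′ , d≢a = inΓ⁻ s a d ad in ⊥-elim (not-¬ (trans (sym (twins d d≢a (≢-sym c≢d))) ad′) ¬cd)
    ... | no b≢c   = trans (sym (inΓ-twins {s} twins c (proj₂ (proj₂ (inΓ⁻ s a c ac))) (≢-sym b≢c))) ac
    fill⇒fill : ∀ c d → fillEdge s a c d ≡ true → fillEdge s b c d ≡ true
    fill⇒fill c d fill with fillEdge⁻ s a c d fill
    ... | c<d , ac , ad , ¬cd = fillEdge⁺ s b c d c<d (b-neighbour c d ac ad (<ᵇ⇒≢ c<d) ¬cd)
      (b-neighbour d c ad ac (≢-sym (<ᵇ⇒≢ c<d)) (trans (symm d c) ¬cd)) ¬cd

  twins-eliminated-induced : ∀ {s : State n} {a b} → TwinsIn s a b →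
    IsInducedSubgraph (eliminate (eliminate s a) b) (eliminate s b)
  twins-eliminated-induced {s} {a} {b} twins = record
    { alive⊆ = λ c c-alive → let c-alive′ , c≢b = alive-eliminate⁻ (eliminate s a) b c c-alive
                              in alive-eliminate⁺ s b c (proj₁ (alive-eliminate⁻ s a c c-alive′)) c≢b
    ; edge≡  = λ c d c-alive d-alive → trans (edge≡ b-removed c d c-alive d-alive)
        (cong (edge s c d ∨_)
          (cong₂ (λ ac ad → ac ∧ ad ∧ not ⌊ c ≟ d ⌋) (same-inΓ c c-alive) (same-inΓ d d-alive)))
    }
    where
    b-removed = eliminate-simplicial-induced {eliminate s a} {b} (twin-simplicial {s} twins)
    same-inΓ : ∀ c → alive (eliminate (eliminate s a) b) c ≡ true → inΓ s a c ≡ inΓ s b c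
    same-inΓ c c-alive = let c-alive′ , c≢b = alive-eliminate⁻ (eliminate s a) b c c-alive
                         in inΓ-twins {s} twins c (proj₂ (alive-eliminate⁻ s a c c-alive′)) c≢b

  record LiveTwins (s : State n) (a b : Fin n) : Set where
    field
      distinct  : a ≢ b
      symmetric : SymmetricEdges s
      twins     : TwinsIn s a b
      a-alive   : alive s a ≡ true
      b-alive   : alive s b ≡ true
  open LiveTwins

  liveTwins-sym : ∀ {s : State n} {a b} → LiveTwins s a b → LiveTwins s b a
  liveTwins-sym {s} t = record
    { distinct = ≢-sym (distinct t) ; symmetric = symmetric t ; twins = twins-sym {s} (twins t)
    ; a-alive = b-alive t ; b-alive = a-alive t }

  eliminate-liveTwins : ∀ {s : State n} {a b} v → v ≢ a → v ≢ b → LiveTwins s a b →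
    LiveTwins (eliminate s v) a b
  eliminate-liveTwins {s} {a} {b} v v≢a v≢b t = record
    { distinct  = distinct t
    ; symmetric = eliminate-symmetric {s} v (symmetric t)
    ; twins     = eliminate-twins {s} v (symmetric t) (twins t) (a-alive t) (b-alive t) v≢a v≢b
    ; a-alive   = alive-eliminate⁺ s v a (a-alive t) (≢-sym v≢a)
    ; b-alive   = alive-eliminate⁺ s v b (b-alive t) (≢-sym v≢b)
    }

  fillList-twins-together : ∀ π₁ π₂ {s : State n} {a b} → LiveTwins s a b →
    Admissible (alive s) (a ∷ π₁ ++ b ∷ π₂) →
    fillList s (a ∷ b ∷ π₁ ++ π₂) ≤ fillList s (a ∷ π₁ ++ b ∷ π₂)
  fillList-twins-together π₁ π₂ {s} {a} t (_ , adm) =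
    +-monoʳ-≤ (deficiency s a)
      (fillList-simplicial-first π₁ π₂ (eliminate-symmetric {s} a (symmetric t)) (twin-simplicial {s} (twins t)) adm)

  fillList-twins-swap : ∀ π {s : State n} {a b} → LiveTwins s a b →
    Admissible (alive s) (a ∷ b ∷ π) → fillList s (a ∷ b ∷ π) ≤ fillList s (b ∷ a ∷ π)
  fillList-twins-swap π {s} {a} {b} t (_ , _ , adm) =
    +-mono-≤ (deficiency-twin-≤ {s} (symmetric t) (twins t))
      (+-mono-≤ (≤-trans (≤-reflexive b-free) z≤n) (fillList-induced π ab⊑ba adm))
    where
    b-free = simplicial-deficiency {eliminate s a} {b} (twin-simplicial {s} (twins t))
    ab⊑ba : IsInducedSubgraph (eliminate (eliminate s a) b) (eliminate (eliminate s b) a)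
    ab⊑ba = induced-via (twins-eliminated-induced {s} (twins t))
      (eliminate-simplicial-induced {eliminate s b} {a} (twin-simplicial {s} (twins-sym {s} (twins t))))
      (without-comm (alive s) a b)

  fillList-twins-first : ∀ π₁ π₂ {s : State n} {a b y z} → LiveTwins s a b → SamePair a b y z →
    Admissible (alive s) (y ∷ π₁ ++ z ∷ π₂) →
    fillList s (a ∷ b ∷ π₁ ++ π₂) ≤ fillList s (y ∷ π₁ ++ z ∷ π₂)
  fillList-twins-first π₁ π₂ t (inj₁ (refl , refl)) adm = fillList-twins-together π₁ π₂ t adm
  fillList-twins-first π₁ π₂ {a = a} {b} t (inj₂ (refl , refl)) adm = ≤-trans
    (fillList-twins-swap (π₁ ++ π₂) t (admissible-swap b a _ (admissible-pull b π₁ a π₂ adm)))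
    (fillList-twins-together π₁ π₂ (liveTwins-sym t) adm)

  fillList-twins-first-after : ∀ p π₁ π₂ {s : State n} {a b y z} → All (λ v → v ≢ a × v ≢ b) p →
    LiveTwins s a b → SamePair a b y z → Admissible (alive s) (p ++ y ∷ π₁ ++ z ∷ π₂) →
    fillList s (p ++ a ∷ b ∷ π₁ ++ π₂) ≤ fillList s (p ++ y ∷ π₁ ++ z ∷ π₂)
  fillList-twins-first-after []      π₁ π₂     []                      t pair adm      =
    fillList-twins-first π₁ π₂ t pair adm
  fillList-twins-first-after (v ∷ p) π₁ π₂ {s} ((v≢a , v≢b) ∷ avoids) t pair (_ , adm) =
    +-monoʳ-≤ (deficiency s v)
      (fillList-twins-first-after p π₁ π₂ avoids (eliminate-liveTwins v v≢a v≢b t) pair adm)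

  record TwinSplit (a b : Fin n) (L : List (Fin n)) : Set where
    constructor twinSplit
    field
      prefix middle suffix : List (Fin n)
      first second         : Fin n
      splits               : L ≡ prefix ++ first ∷ middle ++ second ∷ suffix
      prefix-avoids        : All (λ v → v ≢ a × v ≢ b) prefix
      pair                 : SamePair a b first second

  splitAtTwins : ∀ {a b} L → a ≢ b → a ∈ L → b ∈ L → TwinSplit a b L
  splitAtTwins {a} {b} (x ∷ L) a≢b a∈ b∈ with x ≟ a | x ≟ b
  ... | yes refl | _ with π₁ , π₂ , refl ← ∈-∃++ (Any.tail (≢-sym a≢b) b∈) =
    twinSplit [] π₁ π₂ a b refl [] (inj₁ (refl , refl))
  ... | no _ | yes refl with π₁ , π₂ , refl ← ∈-∃++ (Any.tail a≢b a∈) =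
    twinSplit [] π₁ π₂ b a refl [] (inj₂ (refl , refl))
  ... | no x≢a | no x≢b
    with twinSplit p π₁ π₂ y z refl avoids pair ←
         splitAtTwins L a≢b (Any.tail (x≢a ∘ sym) a∈) (Any.tail (x≢b ∘ sym) b∈) =
    twinSplit (x ∷ p) π₁ π₂ y z refl ((x≢a , x≢b) ∷ avoids) pair

injective⇒surjective : ∀ {n} {f : Fin n → Fin n} → Injective _≡_ _≡_ f → ∀ y → ∃ λ i → f i ≡ y
injective⇒surjective {zero}        _   ()
injective⇒surjective {suc m} {f} inj y with Fin.any? (λ i → f i ≟ y)
... | yes hit  = hit
... | no  miss = collision (Fin.pigeonhole (n<1+n m) (λ i → punchOut (y≢f i)))
  where
  y≢f : ∀ i → y ≢ f i
  y≢f i y≡fi = miss (i , sym y≡fi)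
  collision : ∃₂ (λ i j → i < j × punchOut (y≢f i) ≡ punchOut (y≢f j)) → ∃ λ i → f i ≡ y
  collision (i , j , i<j , same) = ⊥-elim (Fin.<-irrefl (inj (Fin.punchOut-injective (y≢f i) (y≢f j) same)) i<j)

tabulate-lookup-cast : ∀ {A : Set} {m} (L : List A) (len : length L ≡ m) → tabulate (lookup L ∘ cast (sym len)) ≡ L
tabulate-lookup-cast L refl = trans (tabulate-cong (cong (lookup L) ∘ Fin.cast-is-id refl)) (tabulate-lookup L)

length-pull : ∀ {A : Set} (p π₁ π₂ : List A) {x y u w} →
  length (p ++ x ∷ y ∷ π₁ ++ π₂) ≡ length (p ++ u ∷ π₁ ++ w ∷ π₂)
length-pull []      π₁ π₂ {w = w} = cong suc (sym (length-++-sucʳ π₁ w π₂))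
length-pull (_ ∷ p) π₁ π₂         = cong suc (length-pull p π₁ π₂)

indexIn : ∀ {A : Set} (p : List A) {xs : List A} → Fin (length xs) → Fin (length (p ++ xs))
indexIn []      k = k
indexIn (_ ∷ p) k = suc (indexIn p k)

lookup-indexIn : ∀ {A : Set} (p : List A) {xs} (k : Fin (length xs)) → lookup (p ++ xs) (indexIn p k) ≡ lookup xs k
lookup-indexIn []      k = refl
lookup-indexIn (_ ∷ p) k = lookup-indexIn p k

toℕ-indexIn-suc : ∀ {A : Set} (p : List A) {x y : A} {r} →
  toℕ (indexIn p {x ∷ y ∷ r} (suc zero)) ≡ suc (toℕ (indexIn p {x ∷ y ∷ r} zero))
toℕ-indexIn-suc []      = refl
toℕ-indexIn-suc (_ ∷ p) = cong suc (toℕ-indexIn-suc p)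

module _ {n : ℕ} where

  Ordering : List (Fin n) → Set
  Ordering L = length L ≡ n × Admissible (λ _ → true) L

  ordering? : ∀ L → Dec (Ordering L)
  ordering? L = length L ℕ.≟ n ×-dec admissible? _ L

  ordering-lookup : ∀ {L} → Ordering L → Fin n → Fin n
  ordering-lookup {L} (len , _) i = lookup L (cast (sym len) i)

  ordering-lookup-injective : ∀ {L} (o : Ordering L) → Injective _≡_ _≡_ (ordering-lookup o)
  ordering-lookup-injective {L} (len , adm) {i} {j} Li≡Lj = begin
    i                           ≡⟨ Fin.cast-involutive len (sym len) i ⟨
    cast len (cast (sym len) i) ≡⟨ cong (cast len) (admissible-lookup-injective L adm Li≡Lj) ⟩
    cast len (cast (sym len) j) ≡⟨ Fin.cast-involutive len (sym len) j ⟩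
    j                           ∎
    where open ≡-Reasoning

  ordering-∈ : ∀ {L} → Ordering L → ∀ y → y ∈ L
  ordering-∈ {L} o@(len , _) y with i , Li≡y ← injective⇒surjective (ordering-lookup-injective o) y =
    subst (_∈ L) Li≡y (∈-lookup (cast (sym len) i))

  fromOrdering : ∀ {L} → Ordering L → Permutation′ n
  fromOrdering o = permutation (ordering-lookup o) (proj₁ ∘ onto) (proj₂ ∘ onto)
    (λ i → ordering-lookup-injective o (proj₂ (onto (ordering-lookup o i))))
    where
    onto = injective⇒surjective (ordering-lookup-injective o)

  fromOrdering-cast : ∀ {L} (o : Ordering L) k → fromOrdering o ⟨$⟩ʳ cast (proj₁ o) k ≡ lookup L k
  fromOrdering-cast {L} (len , _) k = cong (lookup L) (Fin.cast-involutive (sym len) len k)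

  map-fromOrdering : ∀ {L} (o : Ordering L) → map (fromOrdering o ⟨$⟩ʳ_) (allFin n) ≡ L
  map-fromOrdering {L} o@(len , _) = trans (map-tabulate id (fromOrdering o ⟨$⟩ʳ_)) (tabulate-lookup-cast L len)

  permutation-ordering : (τ : Permutation′ n) → Ordering (map (τ ⟨$⟩ʳ_) (allFin n))
  permutation-ordering τ = subst Ordering (sym (map-tabulate id (τ ⟨$⟩ʳ_)))
    (length-tabulate _ , admissible-tabulate _ (Injection.injective (↔⇒↣ τ)) (λ _ → refl))

  twins-adjacent-ordering : ∀ (G : Graph n) {a b L} → a ≢ b → Twins G a b → Ordering L →
    Σ (List (Fin n)) λ p → Σ (List (Fin n)) λ r →
      Ordering (p ++ a ∷ b ∷ r) × fillList (initial G) (p ++ a ∷ b ∷ r) ≤ fillList (initial G) L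
  twins-adjacent-ordering G {a} {b} {L} a≢b twins o@(len , adm) =
    rearrange (splitAtTwins L a≢b (ordering-∈ o a) (ordering-∈ o b))
    where
    initial-twins : LiveTwins (initial G) a b
    initial-twins = record
      { distinct = a≢b ; symmetric = adj-sym G ; twins = λ c _ _ → twins c ; a-alive = refl ; b-alive = refl }
    rearrange : TwinSplit a b L → Σ (List (Fin n)) λ p → Σ (List (Fin n)) λ r →
      Ordering (p ++ a ∷ b ∷ r) × fillList (initial G) (p ++ a ∷ b ∷ r) ≤ fillList (initial G) L
    rearrange (twinSplit p π₁ π₂ y z refl avoids pair) =
      p , π₁ ++ π₂ ,
      (trans (length-pull p π₁ π₂) len , admissible-prefix p (λ _ → admissible-twins-first π₁ π₂ pair) adm) ,
      fillList-twins-first-after p π₁ π₂ avoids initial-twins pair adm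

lists : ∀ {n} → ℕ → List (List (Fin n))
lists zero    = [ [] ]
lists (suc k) = cartesianProductWith _∷_ (allFin _) (lists k)

∈-lists : ∀ {n} (L : List (Fin n)) → L ∈ lists (length L)
∈-lists []      = Any.here refl
∈-lists (x ∷ L) = ∈-cartesianProductWith⁺ _∷_ (∈-allFin x) (∈-lists L)

minimalOrdering : ∀ {n} (G : Graph n) → Σ (List (Fin n)) λ L →
  Ordering L × (∀ L′ → Ordering L′ → fillList (initial G) L ≤ fillList (initial G) L′)
minimalOrdering {n} G = L , argmin-all fill (permutation-ordering Perm.id) (all-filter ordering? (lists n)) , minimal
  where
  fill = fillList (initial G)
  orderings = filter ordering? (lists n)
  L = argmin fill (map (Perm.id ⟨$⟩ʳ_) (allFin n)) orderings
  minimal : ∀ L′ → Ordering L′ → fill L ≤ fill L′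
  minimal L′ o = All.lookup (f[argmin]≤f[xs] _ orderings)
    (∈-filter⁺ ordering? (subst (λ k → L′ ∈ lists k) (proj₁ o) (∈-lists L′)) o)

theorem4 : ∀ {n} (G : Graph n) (a b : Fin n) → a ≢ b → Twins G a b →
    Σ (Permutation′ n) (λ σ →
      Σ (Fin n) (λ i → Σ (Fin n) (λ j →
        toℕ j ≡ suc (toℕ i) × σ ⟨$⟩ʳ i ≡ a × σ ⟨$⟩ʳ j ≡ b))
      × IsMinimumFillIn G σ)
theorem4 G a b a≢b twins with L , o , minimal ← minimalOrdering G
  with p , r , o′@(len , _) , fill≤ ← twins-adjacent-ordering G a≢b twins o =
  σ , (i , j , adjacent , σi≡a , σj≡b) , optimal
  where
  σ = fromOrdering o′
  i = cast len (indexIn p zero)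
  j = cast len (indexIn p (suc zero))
  adjacent : toℕ j ≡ suc (toℕ i)
  adjacent = trans (Fin.toℕ-cast len _) (trans (toℕ-indexIn-suc p) (cong suc (sym (Fin.toℕ-cast len _))))
  σi≡a : σ ⟨$⟩ʳ i ≡ a
  σi≡a = trans (fromOrdering-cast o′ _) (lookup-indexIn p zero)
  σj≡b : σ ⟨$⟩ʳ j ≡ b
  σj≡b = trans (fromOrdering-cast o′ _) (lookup-indexIn p (suc zero))
  optimal : IsMinimumFillIn G σ
  optimal τ = begin
    fillIn G σ                            ≡⟨ cong (fillList (initial G)) (map-fromOrdering o′) ⟩
    fillList (initial G) (p ++ a ∷ b ∷ r) ≤⟨ fill≤ ⟩
    fillList (initial G) L                ≤⟨ minimal _ (permutation-ordering τ) ⟩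
    fillIn G τ                            ∎
    where open ≤-Reasoning
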